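{- For integers $n \ge 0$ and $0\le k \le n$, let $X_n$ be a uniformly random binary string of length $n$, let $N_{n,k}$ be the number of distinct subsequences of $X_n$ of length $k$, and let $\hat N_{n,k} = \mathbb{E}[N_{n,k}]$. Then for each fixed integer $m \ge 0$, as $n \to \infty$, \[ \hat N_{n,n-m} = 2^{ -m}\binom{n}{m} + O(n^{m-1}). \]
   Context: A subsequence of a string $s = s_0 s_1\cdots s_{n-1}$ is a string $s_{i_1}s_{i_2}\cdots s_{i_k}$ with $0\le i_1<\dots<i_k\le n-1$ (not necessarily contiguous). Subsequences are counted as distinct strings, i.e. different index choices yielding the same string are counted once. -}

module Defs where

open import Data.Bool using (Bool; true; false)
import Data.Bool.Properties as BoolP
open import Data.List using (List; []; _∷_; map; _++_; filter; length)
open import Data.Nat.ListAction using (sum)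
open import Data.Nat using (ℕ; zero; suc)
open import Data.List.Relation.Binary.Sublist.DecPropositional BoolP._≟_ public
  using (_⊆_; _⊆?_)

allStrings : ℕ → List (List Bool)
allStrings zero    = [] ∷ []
allStrings (suc n) = map (false ∷_) (allStrings n) ++ map (true ∷_) (allStrings n)

numSubseq : List Bool → ℕ → ℕ
numSubseq x k = length (filter (λ y → y ⊆? x) (allStrings k))

-- 2^n · E[N_{n,k}] = Σ over all binary strings x of length n of N(x,k)
totalSubseq : ℕ → ℕ → ℕ
totalSubseq n k = sum (map (λ x → numSubseq x k) (allStrings n))

-- Every binary string y of length k is a subsequence of the same number S(k, n)
-- (supersequenceNumber) of binary strings x of length n: matching y against x greedily from
-- the left, a first letter of x equal to the head of y is consumed and any other is skipped,
-- which gives the recursion defining S. Double counting the pairs y ⊆ x turns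
-- 2^n E[N_(n,k)] into 2^k S(k, n), and Pascal's rule gives S(n - m, n) = Σ_(i ≤ m) C(n, i).
-- So 2^m · 2^n E[N_(n,n-m)] − 2^n C(n, m) = 2^n Σ_(i < m) C(n, i) ≤ 2^n m n^(m-1).
module Submission where

open import Defs
open import Data.Nat using (ℕ; _≤_; _∸_; _^_; _*_; _+_)
open import Data.Nat.Combinatorics using (_C_)
open import Data.Integer using (∣_∣; +_) renaming (_-_ to _-ℤ_)
open import Data.Product using (∃₂)

open import Algebra.Properties.CommutativeSemigroup using (interchange; x∙yz≈y∙xz)
open import Data.Bool using (Bool; true; false)
open import Data.Integer using (_⊖_)
open import Data.Integer.Properties using (m-n≡m⊖n; ⊖-≥)
open import Data.List using (List; []; _∷_; map; _++_; filter; length)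
open import Data.List.Properties using (map-++; map-∘; map-cong)
open import Data.List.Relation.Binary.Sublist.Heterogeneous.Properties using (∷⁻¹; ∷ʳ⁻¹)
open import Data.Nat using (zero; suc; _<_; z≤n; s≤s)
open import Data.Nat.Combinatorics using (nCk+nC[k+1]≡[n+1]C[k+1]; k>n⇒nCk≡0)
open import Data.Nat.ListAction using (sum)
open import Data.Nat.ListAction.Properties using (sum-++)
open import Data.Nat.Properties
open import Data.Product using (_,_)
open import Function using (_∘_)
open import Relation.Binary.PropositionalEquality
open import Relation.Nullary using (Dec; does; ¬_)
open import Relation.Nullary.Decidable using (does-⇔)

∑ : ∀ {A : Set} → List A → (A → ℕ) → ℕ
∑ xs f = sum (map f xs)

𝟙 : Bool → ℕ
𝟙 true  = 1
𝟙 false = 0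

∑-++ : ∀ {A : Set} xs ys (f : A → ℕ) → ∑ (xs ++ ys) f ≡ ∑ xs f + ∑ ys f
∑-++ xs ys f = trans (cong sum (map-++ f xs ys)) (sum-++ (map f xs) (map f ys))

∑-map : ∀ {A B : Set} (g : A → B) xs (f : B → ℕ) → ∑ (map g xs) f ≡ ∑ xs (f ∘ g)
∑-map g xs f = cong sum (sym (map-∘ xs))

∑-cong : ∀ {A : Set} {f h : A → ℕ} → (∀ x → f x ≡ h x) → ∀ xs → ∑ xs f ≡ ∑ xs h
∑-cong f≗h xs = cong sum (map-cong f≗h xs)

∑-zero : ∀ {A : Set} (xs : List A) → ∑ xs (λ _ → 0) ≡ 0
∑-zero []       = refl
∑-zero (_ ∷ xs) = ∑-zero xs

∑-+ : ∀ {A : Set} (f h : A → ℕ) xs → ∑ xs (λ x → f x + h x) ≡ ∑ xs f + ∑ xs h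
∑-+ f h []       = refl
∑-+ f h (x ∷ xs) = trans (cong (_+_ (f x + h x)) (∑-+ f h xs))
                         (interchange +-commutativeSemigroup (f x) (h x) (∑ xs f) (∑ xs h))

∑-comm : ∀ {A B : Set} (F : A → B → ℕ) xs ys →
         ∑ xs (λ x → ∑ ys (F x)) ≡ ∑ ys (λ y → ∑ xs (λ x → F x y))
∑-comm F []       ys = sym (∑-zero ys)
∑-comm F (x ∷ xs) ys = trans (cong (_+_ (∑ ys (F x))) (∑-comm F xs ys))
                             (sym (∑-+ (F x) (λ y → ∑ xs (λ x′ → F x′ y)) ys))

length-filter≡∑ : ∀ {A : Set} {P : A → Set} (P? : ∀ x → Dec (P x)) xs →
                  length (filter P? xs) ≡ ∑ xs (𝟙 ∘ does ∘ P?)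
length-filter≡∑ P? []       = refl
length-filter≡∑ P? (x ∷ xs) with does (P? x)
... | true  = cong suc (length-filter≡∑ P? xs)
... | false = length-filter≡∑ P? xs

∑-allStrings-suc : ∀ n (f : List Bool → ℕ) →
                   ∑ (allStrings (suc n)) f ≡ ∑ (allStrings n) (f ∘ (false ∷_)) + ∑ (allStrings n) (f ∘ (true ∷_))
∑-allStrings-suc n f = trans (∑-++ (map (false ∷_) (allStrings n)) (map (true ∷_) (allStrings n)) f)
                             (cong₂ _+_ (∑-map (false ∷_) (allStrings n) f) (∑-map (true ∷_) (allStrings n) f))

∑-allStrings-length : ∀ k (f : ℕ → ℕ) → ∑ (allStrings k) (f ∘ length) ≡ 2 ^ k * f k
∑-allStrings-length zero    f = refl
∑-allStrings-length (suc k) f = begin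
  ∑ (allStrings (suc k)) (f ∘ length)
    ≡⟨ ∑-allStrings-suc k (f ∘ length) ⟩
  ∑ (allStrings k) (f′ ∘ length) + ∑ (allStrings k) (f′ ∘ length)
    ≡⟨ cong₂ _+_ (∑-allStrings-length k f′) (∑-allStrings-length k f′) ⟩
  2 ^ k * f′ k + 2 ^ k * f′ k
    ≡⟨ cong (_+_ (2 ^ k * f′ k)) (sym (+-identityʳ (2 ^ k * f′ k))) ⟩
  2 * (2 ^ k * f′ k)
    ≡⟨ *-assoc 2 (2 ^ k) (f′ k) ⟨
  2 ^ suc k * f (suc k) ∎
  where
  open ≡-Reasoning
  f′ : ℕ → ℕ
  f′ = f ∘ suc

countSupersequences : List Bool → ℕ → ℕ
countSupersequences y n = ∑ (allStrings n) (λ x → 𝟙 (does (y ⊆? x)))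

supersequenceNumber : ℕ → ℕ → ℕ
supersequenceNumber zero    n       = 2 ^ n
supersequenceNumber (suc k) zero    = 0
supersequenceNumber (suc k) (suc n) = supersequenceNumber k n + supersequenceNumber (suc k) n

⊆?-match : ∀ (a : Bool) y x → does ((a ∷ y) ⊆? (a ∷ x)) ≡ does (y ⊆? x)
⊆?-match a y x = sym (does-⇔ (∷⁻¹ refl) (y ⊆? x) ((a ∷ y) ⊆? (a ∷ x)))

⊆?-skip : ∀ {a b : Bool} → ¬ a ≡ b → ∀ y x → does ((a ∷ y) ⊆? (b ∷ x)) ≡ does ((a ∷ y) ⊆? x)
⊆?-skip {a} {b} a≢b y x = sym (does-⇔ (∷ʳ⁻¹ a≢b) ((a ∷ y) ⊆? x) ((a ∷ y) ⊆? (b ∷ x)))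

countSupersequences-match : ∀ a y n →
  ∑ (allStrings n) (λ x → 𝟙 (does ((a ∷ y) ⊆? (a ∷ x)))) ≡ countSupersequences y n
countSupersequences-match a y n = ∑-cong (cong 𝟙 ∘ ⊆?-match a y) (allStrings n)

countSupersequences-skip : ∀ {a b} → ¬ a ≡ b → ∀ y n →
  ∑ (allStrings n) (λ x → 𝟙 (does ((a ∷ y) ⊆? (b ∷ x)))) ≡ countSupersequences (a ∷ y) n
countSupersequences-skip a≢b y n = ∑-cong (cong 𝟙 ∘ ⊆?-skip a≢b y) (allStrings n)

countSupersequences≡supersequenceNumber : ∀ y n → countSupersequences y n ≡ supersequenceNumber (length y) n
countSupersequences≡supersequenceNumber []      zero    = refl
countSupersequences≡supersequenceNumber (_ ∷ _) zero    = refl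
countSupersequences≡supersequenceNumber []      (suc n) =
  trans (∑-allStrings-suc n _) (cong₂ _+_ ih (trans ih (sym (+-identityʳ (2 ^ n)))))
  where ih = countSupersequences≡supersequenceNumber [] n
countSupersequences≡supersequenceNumber (false ∷ y) (suc n) =
  trans (∑-allStrings-suc n _) (cong₂ _+_
    (trans (countSupersequences-match false y n) (countSupersequences≡supersequenceNumber y n))
    (trans (countSupersequences-skip {b = true} (λ ()) y n) (countSupersequences≡supersequenceNumber (false ∷ y) n)))
countSupersequences≡supersequenceNumber (true ∷ y) (suc n) =
  trans (∑-allStrings-suc n _) (trans (cong₂ _+_
    (trans (countSupersequences-skip {b = false} (λ ()) y n) (countSupersequences≡supersequenceNumber (true ∷ y) n))
    (trans (countSupersequences-match true y n) (countSupersequences≡supersequenceNumber y n)))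
    (+-comm (supersequenceNumber (suc (length y)) n) (supersequenceNumber (length y) n)))

totalSubseq≡supersequenceNumber : ∀ n k → totalSubseq n k ≡ 2 ^ k * supersequenceNumber k n
totalSubseq≡supersequenceNumber n k = begin
  totalSubseq n k
    ≡⟨ ∑-cong (λ x → length-filter≡∑ (_⊆? x) (allStrings k)) (allStrings n) ⟩
  ∑ (allStrings n) (λ x → ∑ (allStrings k) (λ y → 𝟙 (does (y ⊆? x))))
    ≡⟨ ∑-comm (λ x y → 𝟙 (does (y ⊆? x))) (allStrings n) (allStrings k) ⟩
  ∑ (allStrings k) (λ y → countSupersequences y n)
    ≡⟨ ∑-cong (λ y → countSupersequences≡supersequenceNumber y n) (allStrings k) ⟩
  ∑ (allStrings k) (λ y → supersequenceNumber (length y) n)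
    ≡⟨ ∑-allStrings-length k (λ j → supersequenceNumber j n) ⟩
  2 ^ k * supersequenceNumber k n ∎
  where open ≡-Reasoning

binomialsBelow : ℕ → ℕ → ℕ
binomialsBelow zero    n = 0
binomialsBelow (suc m) n = n C m + binomialsBelow m n

binomialsBelow-pascal : ∀ m n → binomialsBelow (suc m) (suc n) ≡ binomialsBelow (suc m) n + binomialsBelow m n
binomialsBelow-pascal zero    n = refl
binomialsBelow-pascal (suc m) n = begin
  suc n C suc m + binomialsBelow (suc m) (suc n)
    ≡⟨ cong₂ _+_ (sym (nCk+nC[k+1]≡[n+1]C[k+1] n m)) (binomialsBelow-pascal m n) ⟩
  (n C m + n C suc m) + (binomialsBelow (suc m) n + binomialsBelow m n)
    ≡⟨ cong (_+ (binomialsBelow (suc m) n + binomialsBelow m n)) (+-comm (n C m) (n C suc m)) ⟩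
  (n C suc m + n C m) + (binomialsBelow (suc m) n + binomialsBelow m n)
    ≡⟨ interchange +-commutativeSemigroup (n C suc m) (n C m) (binomialsBelow (suc m) n) (binomialsBelow m n) ⟩
  binomialsBelow (suc (suc m)) n + binomialsBelow (suc m) n ∎
  where open ≡-Reasoning

binomialsBelow-all : ∀ n → binomialsBelow (suc n) n ≡ 2 ^ n
binomialsBelow-all zero    = refl
binomialsBelow-all (suc n) = begin
  binomialsBelow (suc (suc n)) (suc n)
    ≡⟨ binomialsBelow-pascal (suc n) n ⟩
  n C suc n + binomialsBelow (suc n) n + binomialsBelow (suc n) n
    ≡⟨ cong (λ c → c + binomialsBelow (suc n) n + binomialsBelow (suc n) n) (k>n⇒nCk≡0 (n<1+n n)) ⟩
  binomialsBelow (suc n) n + binomialsBelow (suc n) n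
    ≡⟨ cong₂ _+_ (binomialsBelow-all n) (trans (binomialsBelow-all n) (sym (+-identityʳ (2 ^ n)))) ⟩
  2 ^ suc n ∎
  where open ≡-Reasoning

supersequenceNumber-< : ∀ {k n} → n < k → supersequenceNumber k n ≡ 0
supersequenceNumber-< {suc k} {zero}  _         = refl
supersequenceNumber-< {suc k} {suc n} (s≤s n<k) =
  cong₂ _+_ (supersequenceNumber-< n<k) (supersequenceNumber-< (<-trans n<k (n<1+n k)))

supersequenceNumber-diag : ∀ n → supersequenceNumber n n ≡ 1
supersequenceNumber-diag zero    = refl
supersequenceNumber-diag (suc n) = cong₂ _+_ (supersequenceNumber-diag n) (supersequenceNumber-< (n<1+n n))

supersequenceNumber≡binomialsBelow : ∀ k m → supersequenceNumber k (k + m) ≡ binomialsBelow (suc m) (k + m)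
supersequenceNumber≡binomialsBelow zero    m       = sym (binomialsBelow-all m)
supersequenceNumber≡binomialsBelow (suc k) zero    rewrite +-identityʳ k = supersequenceNumber-diag (suc k)
supersequenceNumber≡binomialsBelow (suc k) (suc m) = begin
  supersequenceNumber k (k + suc m) + supersequenceNumber (suc k) (k + suc m)
    ≡⟨ cong₂ _+_ (supersequenceNumber≡binomialsBelow k (suc m))
                 (trans (cong (supersequenceNumber (suc k)) (+-suc k m)) (supersequenceNumber≡binomialsBelow (suc k) m)) ⟩
  binomialsBelow (suc (suc m)) (k + suc m) + binomialsBelow (suc m) (suc k + m)
    ≡⟨ cong (λ j → binomialsBelow (suc (suc m)) (k + suc m) + binomialsBelow (suc m) j) (+-suc k m) ⟨
  binomialsBelow (suc (suc m)) (k + suc m) + binomialsBelow (suc m) (k + suc m)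
    ≡⟨ binomialsBelow-pascal (suc m) (k + suc m) ⟨
  binomialsBelow (suc (suc m)) (suc (k + suc m)) ∎
  where open ≡-Reasoning

nCk≤n^k : ∀ n k → n C k ≤ n ^ k
nCk≤n^k zero    zero    = ≤-refl
nCk≤n^k zero    (suc k) = ≤-reflexive (k>n⇒nCk≡0 {0} {suc k} (s≤s z≤n))
nCk≤n^k (suc n) zero    = ≤-refl
nCk≤n^k (suc n) (suc k) = begin
  suc n C suc k                 ≡⟨ nCk+nC[k+1]≡[n+1]C[k+1] n k ⟨
  n C k + n C suc k             ≤⟨ +-mono-≤ (nCk≤n^k n k) (nCk≤n^k n (suc k)) ⟩
  n ^ k + n * n ^ k             ≤⟨ +-mono-≤ n^k≤ (*-monoʳ-≤ n n^k≤) ⟩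
  suc n ^ suc k                 ∎
  where
  open ≤-Reasoning
  n^k≤ : n ^ k ≤ suc n ^ k
  n^k≤ = ^-monoˡ-≤ k (n≤1+n n)

*-binomialsBelow≤ : ∀ m n → n * binomialsBelow m n ≤ m * n ^ m
*-binomialsBelow≤ zero    n       = ≤-reflexive (*-zeroʳ n)
*-binomialsBelow≤ (suc m) zero    = z≤n
*-binomialsBelow≤ (suc m) (suc n) = begin
  n′ * (n′ C m + binomialsBelow m n′)       ≡⟨ *-distribˡ-+ n′ (n′ C m) (binomialsBelow m n′) ⟩
  n′ * (n′ C m) + n′ * binomialsBelow m n′  ≤⟨ +-mono-≤ (*-monoʳ-≤ n′ (nCk≤n^k n′ m)) (*-binomialsBelow≤ m n′) ⟩
  n′ ^ suc m + m * n′ ^ m                   ≤⟨ +-monoʳ-≤ (n′ ^ suc m) (*-monoʳ-≤ m (m≤n*m (n′ ^ m) n′)) ⟩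
  suc m * n′ ^ suc m                        ∎
  where
  open ≤-Reasoning
  n′ = suc n

∣+[m+n]-+m∣≡n : ∀ m n → ∣ + (m + n) -ℤ + m ∣ ≡ n
∣+[m+n]-+m∣≡n m n = begin
  ∣ + (m + n) -ℤ + m ∣   ≡⟨ cong ∣_∣ (m-n≡m⊖n (m + n) m) ⟩
  ∣ (m + n) ⊖ m ∣        ≡⟨ cong ∣_∣ (⊖-≥ (m≤m+n m n)) ⟩
  m + n ∸ m              ≡⟨ m+n∸m≡n m n ⟩
  n                      ∎
  where open ≡-Reasoning

2^m*totalSubseq[n,n∸m] : ∀ {m n} → m ≤ n →
  2 ^ m * totalSubseq n (n ∸ m) ≡ 2 ^ n * (n C m) + 2 ^ n * binomialsBelow m n
2^m*totalSubseq[n,n∸m] {m} {n} m≤n = begin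
  2 ^ m * totalSubseq n k                          ≡⟨ cong (2 ^ m *_) (totalSubseq≡supersequenceNumber n k) ⟩
  2 ^ m * (2 ^ k * supersequenceNumber k n)        ≡⟨ *-assoc (2 ^ m) (2 ^ k) _ ⟨
  2 ^ m * 2 ^ k * supersequenceNumber k n          ≡⟨ cong (_* supersequenceNumber k n) 2^m*2^k≡2^n ⟩
  2 ^ n * supersequenceNumber k n                  ≡⟨ cong (2 ^ n *_) S[k,n]≡ ⟩
  2 ^ n * binomialsBelow (suc m) n                 ≡⟨ *-distribˡ-+ (2 ^ n) (n C m) (binomialsBelow m n) ⟩
  2 ^ n * (n C m) + 2 ^ n * binomialsBelow m n     ∎
  where
  open ≡-Reasoning
  k = n ∸ m
  k+m≡n : k + m ≡ n
  k+m≡n = m∸n+n≡m m≤n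
  2^m*2^k≡2^n : 2 ^ m * 2 ^ k ≡ 2 ^ n
  2^m*2^k≡2^n = trans (sym (^-distribˡ-+-* 2 m k)) (cong (2 ^_) (trans (+-comm m k) k+m≡n))
  S[k,n]≡ : supersequenceNumber k n ≡ binomialsBelow (suc m) n
  S[k,n]≡ = subst (λ j → supersequenceNumber k j ≡ binomialsBelow (suc m) j) k+m≡n (supersequenceNumber≡binomialsBelow k m)

theorem2 : (m : ℕ) → ∃₂ λ (c N : ℕ) → (n : ℕ) → N ≤ n →
    n * ∣ (+ (2 ^ m * totalSubseq n (n ∸ m))) -ℤ (+ (2 ^ n * (n C m))) ∣
      ≤ c * (2 ^ (n + m) * n ^ m)
theorem2 m = m , m , bound
  where
  open ≤-Reasoning
  bound : ∀ n → m ≤ n → n * ∣ (+ (2 ^ m * totalSubseq n (n ∸ m))) -ℤ (+ (2 ^ n * (n C m))) ∣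
                          ≤ m * (2 ^ (n + m) * n ^ m)
  bound n m≤n = begin
    n * ∣ + (2 ^ m * totalSubseq n (n ∸ m)) -ℤ + (2 ^ n * (n C m)) ∣
      ≡⟨ cong (λ t → n * ∣ + t -ℤ + (2 ^ n * (n C m)) ∣) (2^m*totalSubseq[n,n∸m] m≤n) ⟩
    n * ∣ + (2 ^ n * (n C m) + 2 ^ n * binomialsBelow m n) -ℤ + (2 ^ n * (n C m)) ∣
      ≡⟨ cong (n *_) (∣+[m+n]-+m∣≡n (2 ^ n * (n C m)) (2 ^ n * binomialsBelow m n)) ⟩
    n * (2 ^ n * binomialsBelow m n)   ≡⟨ x∙yz≈y∙xz *-commutativeSemigroup n (2 ^ n) _ ⟩
    2 ^ n * (n * binomialsBelow m n)   ≤⟨ *-monoʳ-≤ (2 ^ n) (*-binomialsBelow≤ m n) ⟩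
    2 ^ n * (m * n ^ m)                ≤⟨ *-monoˡ-≤ (m * n ^ m) (^-monoʳ-≤ 2 (m≤m+n n m)) ⟩
    2 ^ (n + m) * (m * n ^ m)          ≡⟨ x∙yz≈y∙xz *-commutativeSemigroup (2 ^ (n + m)) m (n ^ m) ⟩
    m * (2 ^ (n + m) * n ^ m)          ∎
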